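{- Let $m,n>2$ with $mn$ even, and let $R_{m,n}$ be the $m\times n$ rectangle. Then $$\min\{\mathsf{perim}(D) : D\in\mathcal{D}(R_{m,n})\}\ge 4 \quad\text{and}\quad \max\{\mathsf{perim}(D): D\in\mathcal{D}(R_{m,n})\} \le m+n-2 < \frac{mn}{2}.$$
   Context: A domino is a $1\times 2$ rectangle; $\mathcal{D}(R)$ is the set of tilings of a region $R$ by dominoes on the unit grid. A domino in a tiling of $R$ is a (strong) perimeter domino if one of its sides of length $2$ lies in the boundary of $R$; $\mathsf{perim}(D)$ is the number of perimeter dominoes in $D$. -}

module Defs where

open import Data.Nat using (ℕ; zero; suc; _+_; _<_; _≡ᵇ_)
open import Data.Bool using (Bool; true; false; _∧_; _∨_)
open import Data.List using (List; []; _∷_)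
open import Data.List.Relation.Unary.All using (All)
open import Relation.Binary.PropositionalEquality using (_≡_)

-- Unit grid cells of the m × n rectangle R_{m,n} are pairs (r , c) with
-- r < m (row) and c < n (column).

data Orient : Set where
  hor : Orient   -- covers (r , c) and (r , c + 1)
  ver : Orient   -- covers (r , c) and (r + 1 , c)

record Domino : Set where
  constructor dom
  field
    row : ℕ
    col : ℕ
    dir : Orient
open Domino public

InRect : ℕ → ℕ → Domino → Set
InRect m n (dom r c hor) = r < m × c + 1 < n
  where open import Data.Product using (_×_)
InRect m n (dom r c ver) = r + 1 < m × c < n
  where open import Data.Product using (_×_)

covers : Domino → ℕ → ℕ → Bool
covers (dom r₀ c₀ hor) r c = (r₀ ≡ᵇ r) ∧ ((c₀ ≡ᵇ c) ∨ (c₀ + 1 ≡ᵇ c))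
covers (dom r₀ c₀ ver) r c = (c₀ ≡ᵇ c) ∧ ((r₀ ≡ᵇ r) ∨ (r₀ + 1 ≡ᵇ r))

countB : {A : Set} → (A → Bool) → List A → ℕ
countB p [] = 0
countB p (x ∷ xs) with p x
... | true  = suc (countB p xs)
... | false = countB p xs

IsTiling : ℕ → ℕ → List Domino → Set
IsTiling m n ds =
  All (InRect m n) ds ×
  ((r c : ℕ) → r < m → c < n → countB (λ d → covers d r c) ds ≡ 1)
  where open import Data.Product using (_×_)

-- (Strong) perimeter domino of R_{m,n}: one of its length-2 sides lies on
-- the boundary of the rectangle.  For a horizontal domino the long sides are
-- its top and bottom (rows), for a vertical one its left and right (columns).
isPerim : ℕ → ℕ → Domino → Bool
isPerim m n (dom r c hor) = (r ≡ᵇ 0) ∨ (r + 1 ≡ᵇ m)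
isPerim m n (dom r c ver) = (c ≡ᵇ 0) ∨ (c + 1 ≡ᵇ n)

perim : ℕ → ℕ → List Domino → ℕ
perim m n ds = countB (isPerim m n) ds

-- Double counting.  Every cell of the rectangle is covered by exactly one domino, so for
-- any list of cells, summing over the dominoes of a tiling how many listed cells each
-- covers gives the length of the list.  A domino covering a corner cell is a perimeter
-- domino and, as m, n ≥ 3, covers only one corner; the four corners give perim ≥ 4.
-- List the boundary cells once per side of the rectangle they lie on (2m + 2n entries):
-- a perimeter domino meets this list twice along its long side and once more for each
-- corner it covers, whence 2 perim + 4 ≤ 2 (m + n).  Finally 2 (m + n − 2) < m n is
-- (m − 2)(n − 2) > 0, and m n is even.
module Submission where

open import Defs
open import Data.Nat using (ℕ; _+_; _*_; _∸_; _<_; _≤_; _/_)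
open import Data.Nat.Divisibility using (_∣_)
open import Data.Product using (_×_)
open import Data.List using (List)

open import Data.Bool using (Bool; true; false; _∧_; _∨_)
open import Data.Bool.Properties using (∧-comm; ∨-zeroʳ)
open import Data.Nat using (zero; suc; z≤n; s≤s; _≡ᵇ_; _≤′_; ≤′-refl; ≤′-step)
open import Data.Nat.Properties
open import Data.Nat.Divisibility using (divides)
open import Data.Nat.DivMod using (m*n/n≡m)
open import Data.Nat.ListAction using (sum)
open import Data.Nat.Tactic.RingSolver using (solve-∀)
open import Data.List using ([]; _∷_; _++_; map; length; upTo; cartesianProduct)
open import Data.List.Properties using (map-cong; length-++; length-map; length-upTo; upTo-∷ʳ)
open import Data.List.Relation.Unary.All as All using (All; []; _∷_)
open import Data.List.Relation.Unary.All.Properties using (++⁺; map⁺; applyUpTo⁺₁)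
open import Data.Product using (_,_; proj₁; proj₂; uncurry)
open import Function using (_∘_; flip)
open import Relation.Unary using (Pred; _⟨×⟩_)
open import Relation.Binary.PropositionalEquality
open import Algebra.Properties.CommutativeSemigroup +-commutativeSemigroup using (interchange)

private
  variable
    A B : Set

toℕ : Bool → ℕ
toℕ true  = 1
toℕ false = 0

toℕ≤1 : ∀ b → toℕ b ≤ 1
toℕ≤1 true  = ≤-refl
toℕ≤1 false = z≤n

toℕ-∧ : ∀ a b → toℕ (a ∧ b) ≡ toℕ a * toℕ b
toℕ-∧ true  b = sym (+-identityʳ (toℕ b))
toℕ-∧ false b = refl

≡ᵇ-refl : ∀ i → (i ≡ᵇ i) ≡ true
≡ᵇ-refl zero    = refl
≡ᵇ-refl (suc i) = ≡ᵇ-refl i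

countB-∷ : ∀ (p : A → Bool) x xs → countB p (x ∷ xs) ≡ toℕ (p x) + countB p xs
countB-∷ p x xs with p x
... | true  = refl
... | false = refl

countB-++ : ∀ (p : A → Bool) xs ys → countB p (xs ++ ys) ≡ countB p xs + countB p ys
countB-++ p []       ys = refl
countB-++ p (x ∷ xs) ys = begin
  countB p (x ∷ xs ++ ys)                  ≡⟨ countB-∷ p x (xs ++ ys) ⟩
  toℕ (p x) + countB p (xs ++ ys)          ≡⟨ cong (toℕ (p x) +_) (countB-++ p xs ys) ⟩
  toℕ (p x) + (countB p xs + countB p ys)  ≡⟨ sym (+-assoc (toℕ (p x)) _ _) ⟩
  (toℕ (p x) + countB p xs) + countB p ys  ≡⟨ cong (_+ countB p ys) (sym (countB-∷ p x xs)) ⟩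
  countB p (x ∷ xs) + countB p ys          ∎
  where open ≡-Reasoning

countB-map : ∀ (p : B → Bool) (f : A → B) xs → countB p (map f xs) ≡ countB (p ∘ f) xs
countB-map p f []       = refl
countB-map p f (x ∷ xs) with p (f x)
... | true  = cong suc (countB-map p f xs)
... | false = countB-map p f xs

countB≤length : ∀ (p : A → Bool) xs → countB p xs ≤ length xs
countB≤length p []       = z≤n
countB≤length p (x ∷ xs) with p x
... | true  = s≤s (countB≤length p xs)
... | false = m≤n⇒m≤1+n (countB≤length p xs)

countB-cong : ∀ {p q : A → Bool} → (∀ x → p x ≡ q x) → ∀ xs → countB p xs ≡ countB q xs
countB-cong p≗q []       = refl
countB-cong {p = p} {q} p≗q (x ∷ xs) = begin
  countB p (x ∷ xs)          ≡⟨ countB-∷ p x xs ⟩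
  toℕ (p x) + countB p xs    ≡⟨ cong₂ _+_ (cong toℕ (p≗q x)) (countB-cong p≗q xs) ⟩
  toℕ (q x) + countB q xs    ≡⟨ sym (countB-∷ q x xs) ⟩
  countB q (x ∷ xs)          ∎
  where open ≡-Reasoning

countB-as-sum : ∀ (p : A → Bool) xs → countB p xs ≡ sum (map (toℕ ∘ p) xs)
countB-as-sum p []       = refl
countB-as-sum p (x ∷ xs) = trans (countB-∷ p x xs) (cong (toℕ (p x) +_) (countB-as-sum p xs))

sum-map-+ : ∀ (f g : A → ℕ) xs → sum (map (λ x → f x + g x) xs) ≡ sum (map f xs) + sum (map g xs)
sum-map-+ f g []       = refl
sum-map-+ f g (x ∷ xs) = begin
  f x + g x + sum (map (λ x → f x + g x) xs)         ≡⟨ cong (f x + g x +_) (sum-map-+ f g xs) ⟩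
  f x + g x + (sum (map f xs) + sum (map g xs))      ≡⟨ interchange (f x) (g x) _ _ ⟩
  (f x + sum (map f xs)) + (g x + sum (map g xs))   ∎
  where open ≡-Reasoning

sum-map-zero : ∀ (xs : List A) → sum (map (λ _ → 0) xs) ≡ 0
sum-map-zero []       = refl
sum-map-zero (x ∷ xs) = sum-map-zero xs

sum-map-comm : ∀ (f : A → B → ℕ) xs ys →
  sum (map (λ x → sum (map (f x) ys)) xs) ≡ sum (map (λ y → sum (map (λ x → f x y) xs)) ys)
sum-map-comm f []       ys = sym (sum-map-zero ys)
sum-map-comm f (x ∷ xs) ys = begin
  sum (map (f x) ys) + sum (map (λ x → sum (map (f x) ys)) xs)
    ≡⟨ cong (sum (map (f x) ys) +_) (sum-map-comm f xs ys) ⟩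
  sum (map (f x) ys) + sum (map (λ y → sum (map (λ x → f x y) xs)) ys)
    ≡⟨ sym (sum-map-+ (f x) (λ y → sum (map (λ x → f x y) xs)) ys) ⟩
  sum (map (λ y → sum (map (λ x → f x y) (x ∷ xs))) ys) ∎
  where open ≡-Reasoning

countB-comm : ∀ (R : A → B → Bool) xs ys →
  sum (map (λ x → countB (R x) ys) xs) ≡ sum (map (λ y → countB (flip R y) xs) ys)
countB-comm R xs ys = begin
  sum (map (λ x → countB (R x) ys) xs)
    ≡⟨ cong sum (map-cong (λ x → countB-as-sum (R x) ys) xs) ⟩
  sum (map (λ x → sum (map (λ y → toℕ (R x y)) ys)) xs)
    ≡⟨ sum-map-comm (λ x y → toℕ (R x y)) xs ys ⟩
  sum (map (λ y → sum (map (λ x → toℕ (R x y)) xs)) ys)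
    ≡⟨ cong sum (map-cong (λ y → sym (countB-as-sum (flip R y) xs)) ys) ⟩
  sum (map (λ y → countB (flip R y) xs) ys) ∎
  where open ≡-Reasoning

sum-map-mono : ∀ {f g : A → ℕ} {xs} → All (λ x → f x ≤ g x) xs → sum (map f xs) ≤ sum (map g xs)
sum-map-mono []         = z≤n
sum-map-mono (le ∷ les) = +-mono-≤ le (sum-map-mono les)

sum-map-ones : ∀ {f : A → ℕ} {xs} → All (λ x → f x ≡ 1) xs → sum (map f xs) ≡ length xs
sum-map-ones []         = refl
sum-map-ones (eq ∷ eqs) = cong₂ _+_ eq (sum-map-ones eqs)

countB-∧ˡ : ∀ b (q : A → Bool) xs → countB (λ x → b ∧ q x) xs ≡ toℕ b * countB q xs
countB-∧ˡ b q []       = sym (*-zeroʳ (toℕ b))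
countB-∧ˡ b q (x ∷ xs) = begin
  countB (λ x → b ∧ q x) (x ∷ xs)                      ≡⟨ countB-∷ (λ x → b ∧ q x) x xs ⟩
  toℕ (b ∧ q x) + countB (λ x → b ∧ q x) xs           ≡⟨ cong₂ _+_ (toℕ-∧ b (q x)) (countB-∧ˡ b q xs) ⟩
  toℕ b * toℕ (q x) + toℕ b * countB q xs             ≡⟨ sym (*-distribˡ-+ (toℕ b) (toℕ (q x)) _) ⟩
  toℕ b * (toℕ (q x) + countB q xs)                    ≡⟨ cong (toℕ b *_) (sym (countB-∷ q x xs)) ⟩
  toℕ b * countB q (x ∷ xs)                            ∎
  where open ≡-Reasoning

countB-cartesianProduct : ∀ (p : A → Bool) (q : B → Bool) xs ys →
  countB (uncurry (λ x y → p x ∧ q y)) (cartesianProduct xs ys) ≡ countB p xs * countB q ys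
countB-cartesianProduct p q []       ys = refl
countB-cartesianProduct {A} {B} p q (x ∷ xs) ys = begin
  countB pq (map (x ,_) ys ++ cartesianProduct xs ys)         ≡⟨ countB-++ pq (map (x ,_) ys) _ ⟩
  countB pq (map (x ,_) ys) + countB pq (cartesianProduct xs ys)
    ≡⟨ cong₂ _+_ (trans (countB-map pq (x ,_) ys) (countB-∧ˡ (p x) q ys)) (countB-cartesianProduct p q xs ys) ⟩
  toℕ (p x) * countB q ys + countB p xs * countB q ys          ≡⟨ sym (*-distribʳ-+ (countB q ys) (toℕ (p x)) _) ⟩
  (toℕ (p x) + countB p xs) * countB q ys                      ≡⟨ cong (_* countB q ys) (sym (countB-∷ p x xs)) ⟩
  countB p (x ∷ xs) * countB q ys                              ∎
  where
  open ≡-Reasoning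
  pq : A × B → Bool
  pq = uncurry (λ x y → p x ∧ q y)

length-cartesianProduct : ∀ (xs : List A) (ys : List B) → length (cartesianProduct xs ys) ≡ length xs * length ys
length-cartesianProduct []       ys = refl
length-cartesianProduct (x ∷ xs) ys = begin
  length (map (x ,_) ys ++ cartesianProduct xs ys)           ≡⟨ length-++ (map (x ,_) ys) ⟩
  length (map (x ,_) ys) + length (cartesianProduct xs ys)   ≡⟨ cong₂ _+_ (length-map (x ,_) ys) (length-cartesianProduct xs ys) ⟩
  length ys + length xs * length ys                          ∎
  where open ≡-Reasoning

All-cartesianProduct : ∀ {ℓ} {P : Pred A ℓ} {Q : Pred B ℓ} {xs ys} → All P xs → All Q ys →
  All (P ⟨×⟩ Q) (cartesianProduct xs ys)
All-cartesianProduct []         qs = []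
All-cartesianProduct (px ∷ pxs) qs = ++⁺ (map⁺ (All.map (px ,_) qs)) (All-cartesianProduct pxs qs)

countB-upTo-suc : ∀ (p : ℕ → Bool) k → countB p (upTo (suc k)) ≡ countB p (upTo k) + toℕ (p k)
countB-upTo-suc p k = begin
  countB p (upTo (suc k))            ≡⟨ cong (countB p) (sym (upTo-∷ʳ k)) ⟩
  countB p (upTo k ++ k ∷ [])        ≡⟨ countB-++ p (upTo k) (k ∷ []) ⟩
  countB p (upTo k) + countB p (k ∷ []) ≡⟨ cong (countB p (upTo k) +_) (trans (countB-∷ p k []) (+-identityʳ _)) ⟩
  countB p (upTo k) + toℕ (p k)      ∎
  where open ≡-Reasoning

countB-upTo-mono : ∀ (p : ℕ → Bool) {j k} → j ≤′ k → countB p (upTo j) ≤ countB p (upTo k)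
countB-upTo-mono p ≤′-refl          = ≤-refl
countB-upTo-mono p (≤′-step {k} j≤k) =
  ≤-trans (countB-upTo-mono p j≤k) (≤-trans (m≤m+n _ (toℕ (p k))) (≤-reflexive (sym (countB-upTo-suc p k))))

Cell : Set
Cell = ℕ × ℕ

InRectCell : ℕ → ℕ → Cell → Set
InRectCell m n = (_< m) ⟨×⟩ (_< n)

coverCount : List Cell → Domino → ℕ
coverCount cells d = countB (uncurry (covers d)) cells

sum-coverCount : ∀ {m n D cells} → IsTiling m n D → All (InRectCell m n) cells →
  sum (map (coverCount cells) D) ≡ length cells
sum-coverCount {D = D} {cells} (_ , exactlyOnce) inRect = begin
  sum (map (coverCount cells) D)
    ≡⟨ countB-comm (λ d → uncurry (covers d)) D cells ⟩
  sum (map (λ cell → countB (λ d → uncurry (covers d) cell) D) cells)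
    ≡⟨ sum-map-ones (All.map (λ {(r , c)} (r<m , c<n) → exactlyOnce r c r<m c<n) inRect) ⟩
  length cells ∎
  where open ≡-Reasoning

spans : ℕ → ℕ → Bool
spans i k = (i ≡ᵇ k) ∨ (i + 1 ≡ᵇ k)

isEnd : ℕ → ℕ → Bool
isEnd k i = (i ≡ᵇ 0) ∨ (i + 1 ≡ᵇ k)

meetsRow : Domino → ℕ → Bool
meetsRow (dom r c hor) = r ≡ᵇ_
meetsRow (dom r c ver) = spans r

meetsCol : Domino → ℕ → Bool
meetsCol (dom r c hor) = spans c
meetsCol (dom r c ver) = c ≡ᵇ_

covers≡meetsRow∧meetsCol : ∀ d i j → covers d i j ≡ meetsRow d i ∧ meetsCol d j
covers≡meetsRow∧meetsCol (dom r c hor) i j = refl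
covers≡meetsRow∧meetsCol (dom r c ver) i j = ∧-comm (c ≡ᵇ j) (spans r i)

coverCount-cartesianProduct : ∀ d is js →
  coverCount (cartesianProduct is js) d ≡ countB (meetsRow d) is * countB (meetsCol d) js
coverCount-cartesianProduct d is js =
  trans (countB-cong (λ (i , j) → covers≡meetsRow∧meetsCol d i j) (cartesianProduct is js))
        (countB-cartesianProduct (meetsRow d) (meetsCol d) is js)

ends : ℕ → List ℕ
ends k = 0 ∷ k ∸ 1 ∷ []

corners : ℕ → ℕ → List Cell
corners m n = cartesianProduct (ends m) (ends n)

-- Each boundary cell is listed once for every side of the rectangle it lies on.
border : ℕ → ℕ → List Cell
border m n = cartesianProduct (ends m) (upTo n) ++ cartesianProduct (upTo m) (ends n)

ends-< : ∀ {k} → 0 < k → All (_< k) (ends k)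
ends-< {suc k} _ = s≤s z≤n ∷ ≤-refl ∷ []

upTo-< : ∀ k → All (_< k) (upTo k)
upTo-< k = applyUpTo⁺₁ (λ i → i) k (λ i<k → i<k)

length-border : ∀ m n → length (border m n) ≡ 2 * (m + n)
length-border m n = begin
  length (border m n)
    ≡⟨ length-++ (cartesianProduct (ends m) (upTo n)) ⟩
  length (cartesianProduct (ends m) (upTo n)) + length (cartesianProduct (upTo m) (ends n))
    ≡⟨ cong₂ _+_ (length-cartesianProduct (ends m) (upTo n)) (length-cartesianProduct (upTo m) (ends n)) ⟩
  2 * length (upTo n) + length (upTo m) * 2
    ≡⟨ cong₂ (λ a b → 2 * a + b * 2) (length-upTo n) (length-upTo m) ⟩
  2 * n + m * 2
    ≡⟨ 2*n+m*2≡2*[m+n] m n ⟩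
  2 * (m + n) ∎
  where
  open ≡-Reasoning
  2*n+m*2≡2*[m+n] : ∀ m n → 2 * n + m * 2 ≡ 2 * (m + n)
  2*n+m*2≡2*[m+n] = solve-∀

corners-inRect : ∀ {m n} → 0 < m → 0 < n → All (InRectCell m n) (corners m n)
corners-inRect 0<m 0<n = All-cartesianProduct (ends-< 0<m) (ends-< 0<n)

border-inRect : ∀ {m n} → 0 < m → 0 < n → All (InRectCell m n) (border m n)
border-inRect {m} {n} 0<m 0<n =
  ++⁺ (All-cartesianProduct (ends-< 0<m) (upTo-< n)) (All-cartesianProduct (upTo-< m) (ends-< 0<n))

countB-≡ᵇ-ends : ∀ {k} i → 1 < k → countB (i ≡ᵇ_) (ends k) ≡ toℕ (isEnd k i)
countB-≡ᵇ-ends zero    (s≤s (s≤s _)) = refl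
countB-≡ᵇ-ends {suc (suc k)} (suc i) (s≤s (s≤s _)) =
  trans (trans (countB-∷ (suc i ≡ᵇ_) (suc k) []) (+-identityʳ _))
        (cong (λ x → toℕ (x ≡ᵇ suc k)) (+-comm 1 i))

countB-spans-ends : ∀ {k} i → 2 < k → countB (spans i) (ends k) ≤ 1
countB-spans-ends zero    (s≤s (s≤s (s≤s _))) = ≤-refl
countB-spans-ends {suc k} (suc i) (s≤s (s≤s (s≤s _))) = countB≤length (spans (suc i)) (k ∷ [])

countB-≡ᵇ-upTo : ∀ {k} i → i < k → 1 ≤ countB (i ≡ᵇ_) (upTo k)
countB-≡ᵇ-upTo {k} i i<k = begin
  1                                                ≡⟨ cong toℕ (sym (≡ᵇ-refl i)) ⟩
  toℕ (i ≡ᵇ i)                                     ≤⟨ m≤n+m _ _ ⟩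
  countB (i ≡ᵇ_) (upTo i) + toℕ (i ≡ᵇ i)           ≡⟨ sym (countB-upTo-suc (i ≡ᵇ_) i) ⟩
  countB (i ≡ᵇ_) (upTo (suc i))                    ≤⟨ countB-upTo-mono (i ≡ᵇ_) (≤⇒≤′ i<k) ⟩
  countB (i ≡ᵇ_) (upTo k)                          ∎
  where open ≤-Reasoning

spans-self : ∀ i → spans i i ≡ true
spans-self i = cong (_∨ (i + 1 ≡ᵇ i)) (≡ᵇ-refl i)

spans-suc : ∀ i → spans i (suc i) ≡ true
spans-suc i = trans (cong (λ x → (i ≡ᵇ suc i) ∨ (x ≡ᵇ suc i)) (+-comm i 1))
                    (trans (cong ((i ≡ᵇ suc i) ∨_) (≡ᵇ-refl i)) (∨-zeroʳ (i ≡ᵇ suc i)))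

countB-spans-upTo : ∀ {k} i → i + 1 < k → 2 ≤ countB (spans i) (upTo k)
countB-spans-upTo {k} i i+1<k = begin
  2
    ≡⟨ cong₂ (λ a b → toℕ a + toℕ b) (sym (spans-self i)) (sym (spans-suc i)) ⟩
  toℕ (spans i i) + toℕ (spans i (suc i))
    ≤⟨ +-monoˡ-≤ (toℕ (spans i (suc i))) (m≤n+m (toℕ (spans i i)) (countB (spans i) (upTo i))) ⟩
  countB (spans i) (upTo i) + toℕ (spans i i) + toℕ (spans i (suc i))
    ≡⟨ cong (_+ toℕ (spans i (suc i))) (sym (countB-upTo-suc (spans i) i)) ⟩
  countB (spans i) (upTo (suc i)) + toℕ (spans i (suc i))
    ≡⟨ sym (countB-upTo-suc (spans i) (suc i)) ⟩
  countB (spans i) (upTo (suc (suc i)))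
    ≤⟨ countB-upTo-mono (spans i) (≤⇒≤′ (subst (_< k) (+-comm i 1) i+1<k)) ⟩
  countB (spans i) (upTo k) ∎
  where open ≤-Reasoning

coverCount-border : ∀ m n d → coverCount (border m n) d ≡
  countB (meetsRow d) (ends m) * countB (meetsCol d) (upTo n) + countB (meetsRow d) (upTo m) * countB (meetsCol d) (ends n)
coverCount-border m n d = begin
  coverCount (border m n) d
    ≡⟨ countB-++ (uncurry (covers d)) (cartesianProduct (ends m) (upTo n)) _ ⟩
  coverCount (cartesianProduct (ends m) (upTo n)) d + coverCount (cartesianProduct (upTo m) (ends n)) d
    ≡⟨ cong₂ _+_ (coverCount-cartesianProduct d (ends m) (upTo n)) (coverCount-cartesianProduct d (upTo m) (ends n)) ⟩
  countB (meetsRow d) (ends m) * countB (meetsCol d) (upTo n) + countB (meetsRow d) (upTo m) * countB (meetsCol d) (ends n) ∎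
  where open ≡-Reasoning

-- For a horizontal domino, p = [it is a perimeter domino], s = number of extreme columns
-- it meets, and a, b = numbers of rows and columns it meets: it covers p * s corner cells
-- and meets the border list p * b + a * s times.
product-bounds : ∀ {p s a b} → p ≤ 1 → s ≤ 1 → 1 ≤ a → 2 ≤ b →
  p * s ≤ p × p + p + p * s ≤ p * b + a * s
product-bounds {p} {s} {a} {b} p≤1 s≤1 1≤a 2≤b =
  ≤-trans (*-monoʳ-≤ p s≤1) (≤-reflexive (*-identityʳ p)) ,
  +-mono-≤ (≤-trans (≤-reflexive (p+p≡p*2 p)) (*-monoʳ-≤ p 2≤b)) (*-monoˡ-≤ s (≤-trans p≤1 1≤a))
  where
  p+p≡p*2 : ∀ p → p + p ≡ p * 2
  p+p≡p*2 = solve-∀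

module _ {m n : ℕ} (2<m : 2 < m) (2<n : 2 < n) where

  perimeter-domino-bounds : ∀ d → InRect m n d →
    coverCount (corners m n) d ≤ toℕ (isPerim m n d) ×
    toℕ (isPerim m n d) + toℕ (isPerim m n d) + coverCount (corners m n) d ≤ coverCount (border m n) d
  perimeter-domino-bounds d@(dom r c hor) (r<m , c+1<n)
    rewrite coverCount-cartesianProduct d (ends m) (ends n) | coverCount-border m n d
          | countB-≡ᵇ-ends r (<⇒≤ 2<m)
    = product-bounds (toℕ≤1 (isEnd m r)) (countB-spans-ends c 2<n) (countB-≡ᵇ-upTo r r<m) (countB-spans-upTo c c+1<n)
  perimeter-domino-bounds d@(dom r c ver) (r+1<m , c<n)
    rewrite coverCount-cartesianProduct d (ends m) (ends n) | coverCount-border m n d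
          | countB-≡ᵇ-ends c (<⇒≤ 2<n)
          | *-comm (countB (spans r) (ends m)) (toℕ (isEnd n c))
          | *-comm (countB (spans r) (ends m)) (countB (c ≡ᵇ_) (upTo n))
          | *-comm (countB (spans r) (upTo m)) (toℕ (isEnd n c))
          | +-comm (countB (c ≡ᵇ_) (upTo n) * countB (spans r) (ends m)) (toℕ (isEnd n c) * countB (spans r) (upTo m))
    = product-bounds (toℕ≤1 (isEnd n c)) (countB-spans-ends r 2<m) (countB-≡ᵇ-upTo c c<n) (countB-spans-upTo r r+1<m)

p+p+4≤2*[m+n]⇒p≤m+n∸2 : ∀ {p} m n → p + p + 4 ≤ 2 * (m + n) → p ≤ m + n ∸ 2
p+p+4≤2*[m+n]⇒p≤m+n∸2 {p} m n le =
  m+n≤o⇒m≤o∸n p {2} {m + n} (*-cancelˡ-≤ 2 (≤-trans (≤-reflexive (sym (p+p+4≡2*[p+2] p))) le))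
  where
  p+p+4≡2*[p+2] : ∀ p → p + p + 4 ≡ 2 * (p + 2)
  p+p+4≡2*[p+2] = solve-∀

[m+n∸2]*2<m*n : ∀ {m n} → 2 < m → 2 < n → (m + n ∸ 2) * 2 < m * n
[m+n∸2]*2<m*n {suc (suc (suc a))} {suc (suc (suc b))} (s≤s (s≤s (s≤s _))) (s≤s (s≤s (s≤s _))) =
  subst (suc (a + (3 + b)) * 2 <_) (sym (expand a b)) (s≤s (m≤m+n (suc (a + (3 + b)) * 2) (a + b + a * b)))
  where
  expand : ∀ a b → (3 + a) * (3 + b) ≡ suc (suc (a + (3 + b)) * 2 + (a + b + a * b))
  expand = solve-∀

m+n∸2<m*n/2 : ∀ {m n} → 2 < m → 2 < n → 2 ∣ m * n → m + n ∸ 2 < m * n / 2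
m+n∸2<m*n/2 {m} {n} 2<m 2<n (divides k m*n≡k*2) = begin-strict
  m + n ∸ 2   <⟨ *-cancelʳ-< 2 _ _ (subst ((m + n ∸ 2) * 2 <_) m*n≡k*2 ([m+n∸2]*2<m*n 2<m 2<n)) ⟩
  k           ≡⟨ sym (m*n/n≡m k 2) ⟩
  k * 2 / 2   ≡⟨ cong (_/ 2) (sym m*n≡k*2) ⟩
  m * n / 2   ∎
  where open ≤-Reasoning

module _ {m n : ℕ} (2<m : 2 < m) (2<n : 2 < n) {D : List Domino} (tiling : IsTiling m n D) where

  private
    0<m : 0 < m
    0<m = ≤-trans (s≤s z≤n) 2<m
    0<n : 0 < n
    0<n = ≤-trans (s≤s z≤n) 2<n
    P K : Domino → ℕ
    P = toℕ ∘ isPerim m n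
    K = coverCount (corners m n)
    bounds : All (λ d → K d ≤ P d × P d + P d + K d ≤ coverCount (border m n) d) D
    bounds = All.map (λ {d} → perimeter-domino-bounds 2<m 2<n d) (proj₁ tiling)

    perim≡sum : perim m n D ≡ sum (map P D)
    perim≡sum = countB-as-sum (isPerim m n) D

  4≤perim : 4 ≤ perim m n D
  4≤perim = begin
    4                     ≡⟨ sym (sum-coverCount tiling (corners-inRect 0<m 0<n)) ⟩
    sum (map K D)         ≤⟨ sum-map-mono (All.map proj₁ bounds) ⟩
    sum (map P D)         ≡⟨ sym perim≡sum ⟩
    perim m n D           ∎
    where open ≤-Reasoning

  perim≤m+n∸2 : perim m n D ≤ m + n ∸ 2
  perim≤m+n∸2 = p+p+4≤2*[m+n]⇒p≤m+n∸2 m n (begin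
    perim m n D + perim m n D + 4
      ≡⟨ cong₂ _+_ (cong₂ _+_ perim≡sum perim≡sum) (sym (sum-coverCount tiling (corners-inRect 0<m 0<n))) ⟩
    sum (map P D) + sum (map P D) + sum (map K D)
      ≡⟨ cong (_+ sum (map K D)) (sym (sum-map-+ P P D)) ⟩
    sum (map (λ d → P d + P d) D) + sum (map K D)
      ≡⟨ sym (sum-map-+ (λ d → P d + P d) K D) ⟩
    sum (map (λ d → P d + P d + K d) D)
      ≤⟨ sum-map-mono (All.map proj₂ bounds) ⟩
    sum (map (coverCount (border m n)) D)
      ≡⟨ sum-coverCount tiling (border-inRect 0<m 0<n) ⟩
    length (border m n)
      ≡⟨ length-border m n ⟩
    2 * (m + n) ∎)
    where open ≤-Reasoning

lemma5p7 : (m n : ℕ) → 2 < m → 2 < n → 2 ∣ m * n →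
    ((D : List Domino) → IsTiling m n D → 4 ≤ perim m n D) ×
    ((D : List Domino) → IsTiling m n D → perim m n D ≤ m + n ∸ 2) ×
    (m + n ∸ 2 < (m * n) / 2)
lemma5p7 m n 2<m 2<n 2∣mn =
  (λ D → 4≤perim 2<m 2<n) , (λ D → perim≤m+n∸2 2<m 2<n) , m+n∸2<m*n/2 2<m 2<n 2∣mn
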